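{- Fix integers $k \geq 1$, $j \geq 1$, $s \geq 0$, and a finite rooted ordered tree $\mathcal T$ of height $p \geq 2$, and let $\mathcal K$, $\mathcal K(n)$, $R(n)$, $N(i)$, $\mathcal P R(n)$ and $\nu$ be as in the context. For $n \geq N(p)$, if $\mathcal K(n)$ is complete then \[\mathcal P R(n) = \frac{R(n) - \nu}{k}.\]
   Context: Construction of $\mathcal K$. The children of each node of $\mathcal T$ are linearly ordered; the height of $\mathcal T$ is the length of a longest path from the root to a node. Build finite ordered rooted trees $\mathcal K_1, \mathcal K_2, \dots$: $\mathcal K_p$ is a copy of $\mathcal T$; for $2 \leq i < p$, $\mathcal K_i$ is a copy of $\mathcal K_{i+1}$ with all its leaves deleted; $\mathcal K_1$ is a copy of $\mathcal K_2$ with all its leaves deleted and with one extra node attached as the first child of its root; for $i > p$, $\mathcal K_i$ is a copy of $\mathcal K_{i-1}$ in which exactly $k$ new children are attached to each leaf. The root of $\mathcal K_i$ is the $i$-th supernode; other nodes are regular nodes. $\mathcal K$ consists of all $\mathcal K_i$ together with, for each $i \geq 1$, an edge from the $i$-th supernode to the $(i+1)$-st supernode (the $i$-th supernode being an additional child of the $(i+1)$-st). Traversal order: first the nodes of $\mathcal K_1$: the extra child, then the first supernode, then the remaining children of the first supernode in order; then for $i=2,3,\dots$ the nodes of $\mathcal K_i$ in the usual pre-order of $\mathcal K_i$. Labeling: each supernode receives $s$ labels, each regular node $j$ labels; labels are the consecutive positive integers assigned following the traversal order. A leaf of $\mathcal K$ is a node with no children in $\mathcal K$; a leaf label is a label in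 a leaf of $\mathcal K$. A penultimate node is a non-leaf node of $\mathcal K$ all of whose children are leaves of $\mathcal K$; its labels are penultimate labels. $R(n)$ is the number of leaf labels $\leq n$; $N(i)$ is the largest label in $\mathcal K_i$. $\alpha$ (resp. $\beta$) is the number of leaf labels (resp. penultimate labels) lying in $\mathcal K_1,\dots,\mathcal K_p$, and $\nu = \alpha - k(\beta - s + j)$. For $m \geq 1$, $\mathcal K(m)$ is the subtree of $\mathcal K$ consisting of all nodes up to and including (in traversal order) the node containing label $m$, carrying only the labels $1,\dots,m$. $\mathcal K(m)$ is complete if every penultimate node of $\mathcal K$ contained in $\mathcal K(m)$ has all of its children (in $\mathcal K$) contained in $\mathcal K(m)$, each of these children carrying all $j$ of its labels in $\mathcal K(m)$. Pruning: for $n > N(1)$, $\mathcal P\mathcal K(n)$ is obtained from $\mathcal K(n)$ by deleting every node that is a leaf of $\mathcal K$ (together with its labels), converting the first supernode into a regular node carrying $j$ labels, and relabeling all labels by $1,2,3,\dots$ in traversal order. A label of $\mathcal P\mathcal K(n)$ is a leaf label of $\mathcal P\mathcal K(n)$ if its node is a penultimate node of $\mathcal K$. $\mathcal P R(n)$ is the number of leaf labels of $\mathcal P\mathcal K(n)$. -}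

module Defs where

open import Data.Nat using (ℕ; zero; suc; _∸_; _⊔_; _⊓_; _≤ᵇ_; pred)
open import Data.Bool using (Bool; true; false; if_then_else_; _∧_; not)
open import Data.List using (List; []; _∷_; _++_; map; replicate; upTo; null; [_]; length)
open import Data.Nat.ListAction using (sum)
open import Data.List.Membership.Propositional using (_∈_)
open import Data.Product using (_×_; _,_)
open import Data.Maybe using (Maybe; just; nothing)
open import Data.Integer using (ℤ; +_; _-_) renaming (_+_ to _+ℤ_; _*_ to _*ℤ_)
open import Relation.Binary.PropositionalEquality using (_≡_)

data Tree : Set where
  node : List Tree → Tree

children : Tree → List Tree
children (node ts) = ts

mutual
  height : Tree → ℕ
  height (node []) = 0
  height (node (t ∷ ts)) = suc (maxH (t ∷ ts))

  maxH : List Tree → ℕ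
  maxH [] = 0
  maxH (t ∷ ts) = height t ⊔ maxH ts

-- delete all leaves (the root is kept; it is never a leaf where this is used)
mutual
  deleteLeaves : Tree → Tree
  deleteLeaves (node ts) = node (delL ts)

  delL : List Tree → List Tree
  delL [] = []
  delL (node [] ∷ ts) = delL ts
  delL (node (u ∷ us) ∷ ts) = node (delL (u ∷ us)) ∷ delL ts

mutual
  attach : ℕ → Tree → Tree
  attach k (node []) = node (replicate k (node []))
  attach k (node (t ∷ ts)) = node (attL k (t ∷ ts))

  attL : ℕ → List Tree → List Tree
  attL k [] = []
  attL k (t ∷ ts) = attach k t ∷ attL k ts

allB : {A : Set} → (A → Bool) → List A → Bool
allB P [] = true
allB P (x ∷ xs) = P x ∧ allB P xs

iter : {A : Set} → ℕ → (A → A) → A → A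
iter zero f a = a
iter (suc n) f a = f (iter n f a)

nth : {A : Set} → List A → ℕ → Maybe A
nth [] _ = nothing
nth (x ∷ xs) zero = just x
nth (x ∷ xs) (suc n) = nth xs n

subtree : Tree → List ℕ → Maybe Tree
subtree t [] = just t
subtree (node ts) (c ∷ cs) with nth ts c
... | just u = subtree u cs
... | nothing = nothing

mutual
  pre : Tree → List (List ℕ)
  pre (node ts) = [] ∷ preL 0 ts

  preL : ℕ → List Tree → List (List ℕ)
  preL c [] = []
  preL c (t ∷ ts) = map (c ∷_) (pre t) ++ preL (suc c) ts

-- A node of 𝒦 is addressed by (i , path): the node at `path` in 𝒦_i.
-- The i-th supernode is (i , []).
Addr : Set
Addr = ℕ × List ℕ

module Construction (k j s : ℕ) (T : Tree) where

  p : ℕ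
  p = height T

  -- 𝒦_i (i ≥ 1).  𝒦_1 = (T with p-1 rounds of leaf deletion) plus an extra
  -- first child of the root; for 2 ≤ i ≤ p, T with p-i rounds of deletion;
  -- for i ≥ p, T with i-p rounds of attaching k children to each leaf.
  core1 : Tree
  core1 = iter (p ∸ 1) deleteLeaves T

  Kt : ℕ → Tree
  Kt zero = node []
  Kt (suc zero) = node (node [] ∷ children core1)
  Kt (suc (suc i)) =
    if suc (suc i) ≤ᵇ p then iter (p ∸ suc (suc i)) deleteLeaves T
    else iter (suc (suc i) ∸ p) (attach k) T

  nChildren : Addr → ℕ
  nChildren (i , path) with subtree (Kt i) path
  ... | just (node ts) = length ts
  ... | nothing = 0

  superChild : Addr → List Addr
  superChild (suc (suc i) , []) = [ (suc i , []) ]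
  superChild _ = []

  childrenK : Addr → List Addr
  childrenK (i , path) =
    map (λ c → (i , path ++ [ c ])) (upTo (nChildren (i , path)))
      ++ superChild (i , path)

  isLeafK : Addr → Bool
  isLeafK v = null (childrenK v)

  isPenK : Addr → Bool
  isPenK v = not (isLeafK v) ∧ allB isLeafK (childrenK v)

  order : ℕ → List (List ℕ)
  order (suc zero) = (0 ∷ []) ∷ [] ∷ preL 1 (children core1)
  order i = pre (Kt i)

  trav : ℕ → List Addr
  trav zero = []
  trav (suc m) = trav m ++ map (λ q → (suc m , q)) (order (suc m))

  cnt : Addr → ℕ
  cnt (_ , []) = s
  cnt (_ , _ ∷ _) = j

  go : ℕ → List Addr → List (Addr × ℕ)
  go zero _ = []
  go (suc b) [] = []
  go (suc b) (v ∷ vs) = (v , cnt v ⊓ suc b) ∷ go (suc b ∸ cnt v) vs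

  -- 𝒦(n): every 𝒦_i carries ≥ 1 label, so 𝒦_1..𝒦_n contain labels 1..n
  Kn : ℕ → List (Addr × ℕ)
  Kn n = go n (trav n)

  sumWhere : (Addr → Bool) → List (Addr × ℕ) → ℕ
  sumWhere P [] = 0
  sumWhere P ((v , c) ∷ xs) = (if P v then c else 0) Data.Nat.+ sumWhere P xs

  full : List Addr → List (Addr × ℕ)
  full = map (λ v → (v , cnt v))

  R : ℕ → ℕ
  R n = sumWhere isLeafK (Kn n)

  -- N(i): largest label in 𝒦_i
  N : ℕ → ℕ
  N i = sum (map cnt (trav i))

  α : ℕ
  α = sumWhere isLeafK (full (trav p))

  β : ℕ
  β = sumWhere isPenK (full (trav p))

  ν : ℤ
  ν = + α - (+ k) *ℤ ((+ β - + s) +ℤ + j)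

  isFirstSuper : Addr → Bool
  isFirstSuper (suc zero , []) = true
  isFirstSuper _ = false

  -- 𝒫R(n): labels of 𝒫𝒦(n) in penultimate nodes of 𝒦 (first supernode carries j labels)
  prW : Addr × ℕ → ℕ
  prW (v , c) = if isPenK v then (if isFirstSuper v then j else c) else 0

  PR : ℕ → ℕ
  PR n = sum (map prW (Kn n))

  Complete : ℕ → Set
  Complete n = ∀ v c → (v , c) ∈ Kn n → isPenK v ≡ true →
               ∀ w → w ∈ childrenK v → (w , j) ∈ Kn n

-- Beyond level p, 𝒦 grows by giving every leaf k children, so in the traversal of
-- 𝒦_{p+1}, 𝒦_{p+2}, … every penultimate node is immediately followed by its k leaf children,
-- each carrying j labels, and no other leaf occurs. Completeness of 𝒦(n) means the last such
-- family is not cut off, so past 𝒦_p the leaf labels number exactly k times the labels that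
-- 𝒫𝒦(n) puts on penultimate nodes. Inside 𝒦_1, …, 𝒦_p there are α leaf labels, and 𝒫𝒦(n) has
-- β − s + j leaf labels there, since only the first supernode changes its number of labels.
-- Hence R(n) = α + k (𝒫R(n) − (β − s + j)) = ν + k 𝒫R(n).

module Submission where

open import Defs
open import Data.Nat using (ℕ; _≤_; NonZero)
open import Data.Integer using (+_; _-_)
open import Data.Rational using (_/_)
open import Relation.Binary.PropositionalEquality using (_≡_)

module IntegerArithmetic where
  open import Data.Integer using (_+_; _*_)
  open import Data.Integer.Properties using (pos-+; pos-*; +-inverseʳ; *-zeroʳ; +-identityʳ)
  open import Data.Integer.Tactic.RingSolver using (solve-∀)
  open import Data.Rational.Properties using (fromℚᵘ-cong)
  open import Data.Rational.Unnormalised using (mkℚᵘ; *≡*)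
  import Data.Nat as ℕ
  import Data.Nat.Properties as ℕ
  open import Relation.Binary.PropositionalEquality using (refl; sym; trans; cong; module ≡-Reasoning)
  open ≡-Reasoning

  private
    difference-identity : ∀ x k P a b s j →
      (x + k * P) - (x - k * ((b - s) + j)) ≡ k * (a + P) + k * ((b + j) - (a + s))
    difference-identity = solve-∀

  numerator-identity : ∀ k α β s j A P → A ℕ.+ s ≡ β ℕ.+ j →
    + (α ℕ.+ k ℕ.* P) - (+ α - + k * ((+ β - + s) + + j)) ≡ + (k ℕ.* (A ℕ.+ P))
  numerator-identity k α β s j A P A+s≡β+j = begin
    + (α ℕ.+ k ℕ.* P) - (+ α - + k * ((+ β - + s) + + j))
      ≡⟨ cong (_- (+ α - + k * ((+ β - + s) + + j))) (trans (pos-+ α _) (cong (_+_ (+ α)) (pos-* k P))) ⟩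
    (+ α + + k * + P) - (+ α - + k * ((+ β - + s) + + j))
      ≡⟨ difference-identity (+ α) (+ k) (+ P) (+ A) (+ β) (+ s) (+ j) ⟩
    + k * (+ A + + P) + + k * ((+ β + + j) - (+ A + + s))
      ≡⟨ cong (λ z → + k * (+ A + + P) + + k * (z - (+ A + + s))) β+j≡A+s ⟩
    + k * (+ A + + P) + + k * ((+ A + + s) - (+ A + + s))
      ≡⟨ cong (λ z → + k * (+ A + + P) + + k * z) (+-inverseʳ (+ A + + s)) ⟩
    + k * (+ A + + P) + + k * + 0
      ≡⟨ cong (_+_ (+ k * (+ A + + P))) (*-zeroʳ (+ k)) ⟩
    + k * (+ A + + P) + + 0
      ≡⟨ +-identityʳ _ ⟩
    + k * (+ A + + P)
      ≡⟨ sym (trans (pos-* k _) (cong (+ k *_) (pos-+ A P))) ⟩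
    + (k ℕ.* (A ℕ.+ P)) ∎
    where
    β+j≡A+s : + β + + j ≡ + A + + s
    β+j≡A+s = trans (sym (pos-+ β j)) (trans (cong +_ (sym A+s≡β+j)) (pos-+ A s))

  *-/-cancel : ∀ k′ m → + (ℕ.suc k′ ℕ.* m) / ℕ.suc k′ ≡ + m / 1
  *-/-cancel k′ m = fromℚᵘ-cong {mkℚᵘ (+ (ℕ.suc k′ ℕ.* m)) k′} {mkℚᵘ (+ m) 0} (*≡* cross)
    where
    cross : + (ℕ.suc k′ ℕ.* m) * + 1 ≡ + m * + ℕ.suc k′
    cross = trans (sym (pos-* (ℕ.suc k′ ℕ.* m) 1))
              (trans (cong +_ (trans (ℕ.*-identityʳ (ℕ.suc k′ ℕ.* m)) (ℕ.*-comm (ℕ.suc k′) m))) (pos-* m _))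

  PR-formula : ∀ k′ α β s j A P → A ℕ.+ s ≡ β ℕ.+ j →
    + (A ℕ.+ P) / 1 ≡ (+ (α ℕ.+ ℕ.suc k′ ℕ.* P) - (+ α - + ℕ.suc k′ * ((+ β - + s) + + j))) / ℕ.suc k′
  PR-formula k′ α β s j A P A+s≡β+j =
    sym (trans (cong (_/ ℕ.suc k′) (numerator-identity (ℕ.suc k′) α β s j A P A+s≡β+j))
               (*-/-cancel k′ (A ℕ.+ P)))

open IntegerArithmetic using (PR-formula)

open import Data.Nat using (zero; suc; _+_; _*_; _∸_; _<_; _⊔_; _⊓_; _≤ᵇ_; z≤n; s≤s; z<s; >-nonZero)
open import Data.Nat.Properties
open import Data.Nat.ListAction using (sum)
open import Data.Nat.ListAction.Properties using (sum-++)
open import Data.Nat.Tactic.RingSolver using (solve-∀)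
open import Function using (_∘_)
open import Data.Bool using (Bool; true; false; T; _∧_; not; if_then_else_)
open import Data.Bool.Properties using (∧-assoc; ∧-zeroʳ)
open import Data.List using (List; []; _∷_; _++_; [_]; map; replicate; upTo; applyUpTo; null; length)
open import Data.List.Properties
  using (map-++; ++-assoc; ++-identityʳ; length-++; length-map; length-replicate; ∷-injectiveʳ)
open import Data.List.Membership.Propositional using (_∈_; _∉_)
open import Data.List.Membership.Propositional.Properties
  using (∈-++⁺ˡ; ∈-++⁺ʳ; ∈-++⁻; ∈-map⁺; ∈-map⁻; ∈-upTo⁺)
open import Data.List.Relation.Unary.Any using (here; there)
open import Data.List.Relation.Unary.All as All using (All; []; _∷_)
open import Data.List.Relation.Unary.All.Properties using (++⁺; map⁺; replicate⁺)
open import Data.List.Relation.Unary.AllPairs using ([]; _∷_)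
open import Data.List.Relation.Unary.Unique.Propositional using (Unique)
import Data.List.Relation.Unary.Unique.Propositional.Properties as Unique
open import Data.Maybe using (Maybe; just; nothing; _>>=_)
open import Data.Product using (_×_; _,_; proj₁; proj₂; ∃₂)
open import Data.Sum using (inj₁; inj₂; [_,_]′)
open import Data.Empty using (⊥; ⊥-elim-irr)
open import Data.Unit using (tt)
open import Relation.Nullary using (¬_; contradiction)
open import Relation.Binary.PropositionalEquality
  using (_≢_; refl; sym; trans; cong; cong₂; subst; module ≡-Reasoning)

≤ᵇ-true : ∀ {m n} → m ≤ n → (m ≤ᵇ n) ≡ true
≤ᵇ-true {m} {n} m≤n with m ≤ᵇ n | ≤⇒≤ᵇ m≤n
... | true | _ = refl

≤ᵇ-false : ∀ {m n} → n < m → (m ≤ᵇ n) ≡ false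
≤ᵇ-false {m} {n} n<m with m ≤ᵇ n in eq
... | false = refl
... | true = contradiction (≤ᵇ⇒≤ m n (subst T (sym eq) tt)) (<⇒≱ n<m)

allB-++ : ∀ {A : Set} (P : A → Bool) xs ys → allB P (xs ++ ys) ≡ allB P xs ∧ allB P ys
allB-++ P [] ys = refl
allB-++ P (x ∷ xs) ys = trans (cong (P x ∧_) (allB-++ P xs ys)) (sym (∧-assoc (P x) _ _))

allB-map : ∀ {A B : Set} (P : B → Bool) (f : A → B) xs →
           (∀ x → P (f x) ≡ true) → allB P (map f xs) ≡ true
allB-map P f [] _ = refl
allB-map P f (x ∷ xs) Pf = cong₂ _∧_ (Pf x) (allB-map P f xs Pf)

allB-∷ʳ : ∀ {A : Set} (P : A → Bool) xs {y} → P y ≡ false → allB P (xs ++ [ y ]) ≡ false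
allB-∷ʳ P xs {y} ¬Py =
  trans (allB-++ P xs [ y ]) (trans (cong (λ b → allB P xs ∧ (b ∧ true)) ¬Py) (∧-zeroʳ _))

null-∷ʳ : ∀ {A : Set} (xs : List A) y → null (xs ++ [ y ]) ≡ false
null-∷ʳ [] y = refl
null-∷ʳ (x ∷ xs) y = refl

unique-++-∷⇒∉ : ∀ {A : Set} (as : List A) {w bs} → Unique (as ++ w ∷ bs) → w ∉ as
unique-++-∷⇒∉ (a ∷ as) (a≢ ∷ _) (here refl) = All.lookup a≢ (∈-++⁺ʳ as (here refl)) refl
unique-++-∷⇒∉ (a ∷ as) (_ ∷ unique) (there w∈) = unique-++-∷⇒∉ as unique w∈

private
  1+[[1+m⊔n]∸1]≡1+m⊔n : ∀ m n → suc ((suc m ⊔ n) ∸ 1) ≡ suc m ⊔ n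
  1+[[1+m⊔n]∸1]≡1+m⊔n m zero = refl
  1+[[1+m⊔n]∸1]≡1+m⊔n m (suc n) = refl

mutual
  maxH-delL : ∀ ts → maxH (delL ts) ≡ maxH ts ∸ 1
  maxH-delL [] = refl
  maxH-delL (node [] ∷ ts) = maxH-delL ts
  maxH-delL (node (u ∷ us) ∷ ts) = trans
    (cong₂ _⊔_ (height-node-delL (u ∷ us)) (maxH-delL ts))
    (sym (∸-distribʳ-⊔ 1 (suc (maxH (u ∷ us))) (maxH ts)))

  height-node-delL : ∀ ts → height (node (delL ts)) ≡ maxH ts
  height-node-delL [] = refl
  height-node-delL (node [] ∷ ts) = height-node-delL ts
  height-node-delL (node (u ∷ us) ∷ ts) = trans
    (cong suc (maxH-delL (node (u ∷ us) ∷ ts)))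
    (1+[[1+m⊔n]∸1]≡1+m⊔n (maxH (u ∷ us)) (maxH ts))

height-deleteLeaves : ∀ t → height (deleteLeaves t) ≡ height t ∸ 1
height-deleteLeaves (node []) = refl
height-deleteLeaves (node (u ∷ us)) = height-node-delL (u ∷ us)

height-iter-deleteLeaves : ∀ m t → height (iter m deleteLeaves t) ≡ height t ∸ m
height-iter-deleteLeaves zero t = refl
height-iter-deleteLeaves (suc m) t = begin
  height (deleteLeaves (iter m deleteLeaves t)) ≡⟨ height-deleteLeaves (iter m deleteLeaves t) ⟩
  height (iter m deleteLeaves t) ∸ 1           ≡⟨ cong (_∸ 1) (height-iter-deleteLeaves m t) ⟩
  height t ∸ m ∸ 1                             ≡⟨ ∸-+-assoc (height t) m 1 ⟩
  height t ∸ (m + 1)                           ≡⟨ cong (height t ∸_) (+-comm m 1) ⟩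
  height t ∸ suc m                             ∎
  where open ≡-Reasoning

maxH≡0⇒leaves : ∀ ts → maxH ts ≡ 0 → All (_≡ node []) ts
maxH≡0⇒leaves [] _ = []
maxH≡0⇒leaves (node [] ∷ ts) eq = refl ∷ maxH≡0⇒leaves ts eq
maxH≡0⇒leaves (node (u ∷ us) ∷ ts) eq =
  contradiction (subst (suc (maxH (u ∷ us)) ≤_) eq (m≤m⊔n _ (maxH ts))) λ ()

height≤1⇒leaf-children : ∀ t → height t ≤ 1 → All (_≡ node []) (children t)
height≤1⇒leaf-children (node []) _ = []
height≤1⇒leaf-children (node (u ∷ us)) (s≤s h≤0) = maxH≡0⇒leaves (u ∷ us) (n≤0⇒n≡0 h≤0)

Branching : Tree → Set
Branching t = ∃₂ λ c cs → t ≡ node (c ∷ cs)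

0<height⇒branching : ∀ t → 0 < height t → Branching t
0<height⇒branching (node (c ∷ cs)) _ = c , cs , refl

iter-attach-branching : ∀ k m {t} → Branching t → Branching (iter m (attach k) t)
iter-attach-branching k zero b = b
iter-attach-branching k (suc m) b with iter-attach-branching k m b
... | c , cs , eq = attach k c , attL k cs , cong (attach k) eq

subtree-++ : ∀ t q r → subtree t (q ++ r) ≡ (subtree t q >>= λ u → subtree u r)
subtree-++ t [] r = refl
subtree-++ (node ts) (c ∷ q) r with nth ts c
... | just u = subtree-++ u q r
... | nothing = refl

subtree-child : ∀ ts c → subtree (node ts) [ c ] ≡ nth ts c
subtree-child ts c with nth ts c
... | just u = refl
... | nothing = refl

nth-length : ∀ {A : Set} (xs : List A) x ys → nth (xs ++ x ∷ ys) (length xs) ≡ just x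
nth-length [] x ys = refl
nth-length (_ ∷ xs) x ys = nth-length xs x ys

subtree-∷ʳ : ∀ t q ts c → subtree t q ≡ just (node ts) → subtree t (q ++ [ c ]) ≡ nth ts c
subtree-∷ʳ t q ts c at-q = begin
  subtree t (q ++ [ c ])                     ≡⟨ subtree-++ t q [ c ] ⟩
  (subtree t q >>= λ u → subtree u [ c ])    ≡⟨ cong (_>>= λ u → subtree u [ c ]) at-q ⟩
  subtree (node ts) [ c ]                    ≡⟨ subtree-child ts c ⟩
  nth ts c                                   ∎
  where open ≡-Reasoning

leafOf : Maybe Tree → Bool
leafOf (just (node [])) = true
leafOf (just (node (_ ∷ _))) = false
leafOf nothing = true

childCount : Maybe Tree → ℕ
childCount (just (node ts)) = length ts
childCount nothing = 0

leafOf-nth : ∀ {ts} → All (_≡ node []) ts → ∀ c → leafOf (nth ts c) ≡ true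
leafOf-nth [] c = refl
leafOf-nth (refl ∷ _) zero = refl
leafOf-nth (_ ∷ leaves) (suc c) = leafOf-nth leaves c

leafOf-attach : ∀ k′ t → leafOf (just (attach (suc k′) t)) ≡ false
leafOf-attach k′ (node []) = refl
leafOf-attach k′ (node (_ ∷ _)) = refl

preL-replicate-∷ʳ : ∀ c m →
  preL c (replicate (suc m) (node [])) ≡ preL c (replicate m (node [])) ++ [ [ c + m ] ]
preL-replicate-∷ʳ c zero = cong (λ d → [ [ d ] ]) (sym (+-identityʳ c))
preL-replicate-∷ʳ c (suc m) = cong ([ c ] ∷_)
  (trans (preL-replicate-∷ʳ (suc c) m)
         (cong (λ d → preL (suc c) (replicate m (node [])) ++ [ [ d ] ]) (sym (+-suc c m))))

length-preL-replicate : ∀ c m → length (preL c (replicate m (node []))) ≡ m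
length-preL-replicate c zero = refl
length-preL-replicate c (suc m) = cong suc (length-preL-replicate (suc c) m)

HeadAtLeast : ℕ → List ℕ → Set
HeadAtLeast c [] = ⊥
HeadAtLeast c (d ∷ _) = c ≤ d

preL-heads : ∀ c ts → All (HeadAtLeast c) (preL c ts)
preL-heads c [] = []
preL-heads c (t ∷ ts) =
  ++⁺ (map⁺ (All.universal (λ _ → ≤-refl) (pre t))) (All.map weaken (preL-heads (suc c) ts))
  where
  weaken : ∀ {q} → HeadAtLeast (suc c) q → HeadAtLeast c q
  weaken {_ ∷ _} = <⇒≤

heads⇒≢ : ∀ {c q qs} → ¬ HeadAtLeast c q → All (HeadAtLeast c) qs → All (q ≢_) qs
heads⇒≢ ¬head = All.map λ head q≡ → ¬head (subst (HeadAtLeast _) (sym q≡) head)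

mutual
  pre-unique : ∀ t → Unique (pre t)
  pre-unique (node ts) = heads⇒≢ (λ ()) (preL-heads 0 ts) ∷ preL-unique 0 ts

  preL-unique : ∀ c ts → Unique (preL c ts)
  preL-unique c [] = []
  preL-unique c (t ∷ ts) =
    Unique.++⁺ (Unique.map⁺ ∷-injectiveʳ (pre-unique t)) (preL-unique (suc c) ts) disjoint
    where
    disjoint : ∀ {q} → ¬ (q ∈ map (c ∷_) (pre t) × q ∈ preL (suc c) ts)
    disjoint (q∈l , q∈r) with ∈-map⁻ (c ∷_) q∈l
    ... | _ , _ , refl = 1+n≰n (All.lookup (preL-heads (suc c) ts) q∈r)

module ConstructionProperties (k′ j′ s : ℕ) (T : Tree) (2≤p : 2 ≤ height T) where
  open Construction (suc k′) (suc j′) s T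

  k j : ℕ
  k = suc k′
  j = suc j′

  order-unique : ∀ i → Unique (order (suc i))
  order-unique zero = ((λ ()) ∷ heads⇒≢ (λ ()) (preL-heads 1 (children core1)))
                    ∷ heads⇒≢ (λ ()) (preL-heads 1 (children core1))
                    ∷ preL-unique 1 (children core1)
  order-unique (suc i) = pre-unique (Kt (suc (suc i)))

  ∈-trav⇒≤ : ∀ m {a} → a ∈ trav m → proj₁ a ≤ m
  ∈-trav⇒≤ (suc m) a∈ with ∈-++⁻ (trav m) a∈
  ... | inj₁ a∈trav = m≤n⇒m≤1+n (∈-trav⇒≤ m a∈trav)
  ... | inj₂ a∈level with ∈-map⁻ (suc m ,_) a∈level
  ...   | _ , _ , refl = ≤-refl

  trav-unique : ∀ m → Unique (trav m)
  trav-unique zero = []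
  trav-unique (suc m) =
    Unique.++⁺ (trav-unique m) (Unique.map⁺ (cong proj₂) (order-unique m)) disjoint
    where
    disjoint : ∀ {a} → ¬ (a ∈ trav m × a ∈ map (suc m ,_) (order (suc m)))
    disjoint (a∈l , a∈r) with ∈-map⁻ (suc m ,_) a∈r
    ... | _ , _ , refl = 1+n≰n (∈-trav⇒≤ m a∈l)

  -- Truncating a traversal to a label budget

  labels : List Addr → ℕ
  labels xs = sum (map cnt xs)

  labels-++ : ∀ xs ys → labels (xs ++ ys) ≡ labels xs + labels ys
  labels-++ xs ys = trans (cong sum (map-++ cnt xs ys)) (sum-++ (map cnt xs) (map cnt ys))

  -- go stops as soon as the budget is exhausted, so it lays down a whole segment only when
  -- the segment's last node carries a label (supernodes carry s labels, possibly none).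
  data LastLabelled : List Addr → Set where
    end : ∀ {z} → 0 < cnt z → LastLabelled (z ∷ [])
    _∷_ : ∀ z {zs} → LastLabelled zs → LastLabelled (z ∷ zs)

  LastLabelled⇒0<labels : ∀ {zs} → LastLabelled zs → 0 < labels zs
  LastLabelled⇒0<labels (end {z} 0<z) = ≤-trans 0<z (m≤m+n (cnt z) 0)
  LastLabelled⇒0<labels (z ∷ last) = ≤-trans (LastLabelled⇒0<labels last) (m≤n+m _ (cnt z))

  LastLabelled-∷ʳ : ∀ ws {w} → 0 < cnt w → LastLabelled (ws ++ [ w ])
  LastLabelled-∷ʳ [] 0<w = end 0<w
  LastLabelled-∷ʳ (x ∷ ws) 0<w = x ∷ LastLabelled-∷ʳ ws 0<w

  LastLabelled-++ : ∀ xs {zs} → LastLabelled zs → LastLabelled (xs ++ zs)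
  LastLabelled-++ [] last = last
  LastLabelled-++ (x ∷ xs) last = x ∷ LastLabelled-++ xs last

  go-++ : ∀ {zs} xs b → LastLabelled zs → labels zs ≤ b → go b (zs ++ xs) ≡ full zs ++ go (b ∸ labels zs) xs
  go-++ xs zero last zs≤0 = contradiction (≤-trans (LastLabelled⇒0<labels last) zs≤0) λ ()
  go-++ xs (suc b) (end {z} _) z≤b = cong₂ (λ c b′ → (z , c) ∷ go b′ xs)
    (m≤n⇒m⊓n≡m (≤-trans (m≤m+n (cnt z) 0) z≤b)) (cong (suc b ∸_) (sym (+-identityʳ (cnt z))))
  go-++ xs (suc b) (_∷_ z {zs} last) zzs≤b = cong₂ (λ c ys → (z , c) ∷ ys)
    (m≤n⇒m⊓n≡m (≤-trans (m≤m+n (cnt z) (labels zs)) zzs≤b))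
    (trans (go-++ xs (suc b ∸ cnt z) last zs≤b∸z)
           (cong (λ b′ → full zs ++ go b′ xs) (∸-+-assoc (suc b) (cnt z) (labels zs))))
    where
    zs≤b∸z : labels zs ≤ suc b ∸ cnt z
    zs≤b∸z = ≤-trans (≤-reflexive (sym (m+n∸m≡n (cnt z) (labels zs)))) (∸-monoˡ-≤ (cnt z) zzs≤b)

  go-truncates : ∀ zs {w xs c} b → w ∉ zs → 0 < cnt w → b < labels zs + cnt w →
                 (w , c) ∈ go b (zs ++ w ∷ xs) → c < cnt w
  go-truncates [] {w} (suc b) _ _ b<w (here refl) = subst (_< cnt w) (sym (m≥n⇒m⊓n≡n (<⇒≤ b<w))) b<w
  go-truncates [] {w} {xs} {c} (suc b) _ _ b<w (there w∈) =
    contradiction (subst (λ b′ → (w , c) ∈ go b′ xs) (m≤n⇒m∸n≡0 (<⇒≤ b<w)) w∈) λ ()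
  go-truncates (z ∷ zs) (suc b) w∉ _ _ (here refl) = contradiction (here refl) w∉
  go-truncates (z ∷ zs) {w} (suc b) w∉ 0<w b<zzsw (there w∈) =
    go-truncates zs (suc b ∸ cnt z) (w∉ ∘ there) 0<w b∸z<zsw w∈
    where
    b∸z<zsw : suc b ∸ cnt z < labels zs + cnt w
    b∸z<zsw = m<n+o⇒m∸n<o (suc b) (cnt z) {{>-nonZero (≤-trans 0<w (m≤n+m _ (labels zs)))}}
      (subst (suc b <_) (+-assoc (cnt z) (labels zs) (cnt w)) b<zzsw)

  leafSum penSum prSum : List (Addr × ℕ) → ℕ
  leafSum = sumWhere isLeafK
  penSum = sumWhere isPenK
  prSum X = sum (map prW X)

  sumWhere-++ : ∀ P X Y → sumWhere P (X ++ Y) ≡ sumWhere P X + sumWhere P Y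
  sumWhere-++ P [] Y = refl
  sumWhere-++ P ((v , c) ∷ X) Y = trans (cong (_+_ (if P v then c else 0)) (sumWhere-++ P X Y))
                                        (sym (+-assoc (if P v then c else 0) _ _))

  prSum-++ : ∀ X Y → prSum (X ++ Y) ≡ prSum X + prSum Y
  prSum-++ X Y = trans (cong sum (map-++ prW X Y)) (sum-++ (map prW X) (map prW Y))

  isPenK⇒¬isLeafK : ∀ v → isPenK v ≡ true → isLeafK v ≡ false
  isPenK⇒¬isLeafK v pen with isLeafK v
  ... | false = refl

  isLeafK⇒¬isPenK : ∀ v → isLeafK v ≡ true → isPenK v ≡ false
  isLeafK⇒¬isPenK v leaf = cong (λ l → not l ∧ allB isLeafK (childrenK v)) leaf

  FullLeaf : Addr → Set
  FullLeaf w = isLeafK w ≡ true × cnt w ≡ j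

  leafSum-FullLeaf : ∀ {ws} → All FullLeaf ws → leafSum (full ws) ≡ length ws * j
  leafSum-FullLeaf [] = refl
  leafSum-FullLeaf {w ∷ _} ((leaf , cnt≡j) ∷ rest) =
    cong₂ _+_ (trans (cong (λ l → if l then cnt w else 0) leaf) cnt≡j) (leafSum-FullLeaf rest)

  prSum-FullLeaf : ∀ {ws} → All FullLeaf ws → prSum (full ws) ≡ 0
  prSum-FullLeaf [] = refl
  prSum-FullLeaf {w ∷ _} ((leaf , _) ∷ rest) =
    cong₂ _+_ (cong (λ q → if q then (if isFirstSuper w then j else cnt w) else 0) (isLeafK⇒¬isPenK w leaf))
              (prSum-FullLeaf rest)

  -- The shape of the traversal beyond 𝒦_p; the last leaf w of a family is recorded as a
  -- child of v because completeness is what forces it into 𝒦(n).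
  data Blocks : List Addr → Set where
    [] : Blocks []
    inner : ∀ {xs} v → isLeafK v ≡ false → isPenK v ≡ false → Blocks xs → Blocks (v ∷ xs)
    family : ∀ {xs} v ws w → isPenK v ≡ true → isFirstSuper v ≡ false → cnt v ≡ j →
             All FullLeaf ws → FullLeaf w → length ws ≡ k′ → w ∈ childrenK v →
             Blocks xs → Blocks (v ∷ ws ++ w ∷ xs)

  Blocks-++ : ∀ {xs ys} → Blocks xs → Blocks ys → Blocks (xs ++ ys)
  Blocks-++ [] bys = bys
  Blocks-++ (inner v ¬leaf ¬pen bxs) bys = inner v ¬leaf ¬pen (Blocks-++ bxs bys)
  Blocks-++ {ys = ys} (family {xs} v ws w pen ¬first cnt≡j leaves last len w∈ bxs) bys =
    subst Blocks (cong (v ∷_) (sym (++-assoc ws (w ∷ xs) ys)))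
      (family v ws w pen ¬first cnt≡j leaves last len w∈ (Blocks-++ bxs bys))

  family-leafSum : ∀ {v ws w} → isPenK v ≡ true → All FullLeaf ws → FullLeaf w → length ws ≡ k′ →
                   leafSum (full (v ∷ ws ++ [ w ])) ≡ k * j
  family-leafSum {v} {ws} {w} pen leaves last len = cong₂ _+_
    (cong (λ l → if l then cnt v else 0) (isPenK⇒¬isLeafK v pen))
    (trans (leafSum-FullLeaf (++⁺ leaves (last ∷ [])))
           (cong (_* j) (trans (length-++ ws) (trans (+-comm (length ws) 1) (cong suc len)))))

  family-prSum : ∀ {v ws w} → isPenK v ≡ true → isFirstSuper v ≡ false → cnt v ≡ j →
                 All FullLeaf ws → FullLeaf w → prSum (full (v ∷ ws ++ [ w ])) ≡ j
  family-prSum {v} pen ¬first cnt≡j leaves last = trans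
    (cong₂ _+_ (trans (cong (λ q → if q then (if isFirstSuper v then j else cnt v) else 0) pen)
                      (trans (cong (λ f → if f then j else cnt v) ¬first) cnt≡j))
               (prSum-FullLeaf (++⁺ leaves (last ∷ []))))
    (+-identityʳ j)

  CompleteList : List (Addr × ℕ) → Set
  CompleteList Y = ∀ v c → (v , c) ∈ Y → isPenK v ≡ true → ∀ w → w ∈ childrenK v → (w , j) ∈ Y

  family-fits : ∀ (E : List (Addr × ℕ)) {v ws w xs} b → isPenK v ≡ true → FullLeaf w → w ∈ childrenK v →
                Unique (map proj₁ E ++ v ∷ ws ++ w ∷ xs) →
                CompleteList (E ++ go (suc b) (v ∷ ws ++ w ∷ xs)) →
                labels (v ∷ ws) + cnt w ≤ suc b
  family-fits E {v} {ws} {w} {xs} b pen (_ , cnt≡j) w∈ unique complete = ≮⇒≥ λ b<block →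
    [ (λ w∈E → w∉ (∈-++⁺ˡ (∈-map⁺ proj₁ w∈E)))
    , (λ w∈go → <-irrefl refl
         (subst (j <_) cnt≡j (go-truncates (v ∷ ws) (suc b) (w∉ ∘ ∈-++⁺ʳ (map proj₁ E)) 0<w b<block w∈go)))
    ]′ (∈-++⁻ E (complete v _ (∈-++⁺ʳ E (here refl)) pen w w∈))
    where
    0<w : 0 < cnt w
    0<w = subst (0 <_) (sym cnt≡j) z<s
    w∉ : w ∉ map proj₁ E ++ v ∷ ws
    w∉ = unique-++-∷⇒∉ (map proj₁ E ++ v ∷ ws)
           (subst Unique (sym (++-assoc (map proj₁ E) (v ∷ ws) (w ∷ xs))) unique)

  unique-shift : ∀ (E F : List (Addr × ℕ)) {xs} →
                 Unique (map proj₁ E ++ map proj₁ F ++ xs) → Unique (map proj₁ (E ++ F) ++ xs)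
  unique-shift E F {xs} = subst Unique (sym (trans (cong (_++ xs) (map-++ proj₁ E F))
                                                   (++-assoc (map proj₁ E) (map proj₁ F) xs)))

  complete-shift : ∀ (E F Y : List (Addr × ℕ)) → CompleteList (E ++ F ++ Y) → CompleteList ((E ++ F) ++ Y)
  complete-shift E F Y = subst CompleteList (sym (++-assoc E F Y))

  proj₁-full : ∀ xs → map proj₁ (full xs) ≡ xs
  proj₁-full [] = refl
  proj₁-full (x ∷ xs) = cong (x ∷_) (proj₁-full xs)

  -- The accumulator E is the part of 𝒦(n) already read; uniqueness of addresses is what
  -- forbids a penultimate node's last child to have been listed there instead.
  leafSum≡k*prSum : ∀ (E : List (Addr × ℕ)) {xs} b → Blocks xs →
                    Unique (map proj₁ E ++ xs) → CompleteList (E ++ go b xs) →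
                    leafSum (go b xs) ≡ k * prSum (go b xs)
  leafSum≡k*prSum E zero _ _ _ = sym (*-zeroʳ k)
  leafSum≡k*prSum E (suc b) [] _ _ = sym (*-zeroʳ k)
  leafSum≡k*prSum E (suc b) (inner {xs} v ¬leaf ¬pen blocks) unique complete = begin
    leafSum ((v , c) ∷ Y)    ≡⟨ cong (λ l → (if l then c else 0) + leafSum Y) ¬leaf ⟩
    leafSum Y                ≡⟨ leafSum≡k*prSum (E ++ [ (v , c) ]) (suc b ∸ cnt v) blocks
                                  (unique-shift E [ (v , c) ] unique) (complete-shift E _ Y complete) ⟩
    k * prSum Y              ≡⟨ cong (λ q → k * ((if q then (if isFirstSuper v then j else c) else 0) + prSum Y))
                                     (sym ¬pen) ⟩
    k * prSum ((v , c) ∷ Y)  ∎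
    where
    open ≡-Reasoning
    c = cnt v ⊓ suc b
    Y = go (suc b ∸ cnt v) xs
  leafSum≡k*prSum E (suc b) (family {xs} v ws w pen ¬first cnt≡j leaves last len w∈ blocks) unique complete =
    begin
    leafSum (go (suc b) (v ∷ ws ++ w ∷ xs))  ≡⟨ cong leafSum split ⟩
    leafSum (full zs ++ Y)                   ≡⟨ sumWhere-++ isLeafK (full zs) Y ⟩
    leafSum (full zs) + leafSum Y            ≡⟨ cong₂ _+_ (family-leafSum {v} pen leaves last len) IH ⟩
    k * j + k * prSum Y                      ≡⟨ *-distribˡ-+ k j (prSum Y) ⟨
    k * (j + prSum Y)                        ≡⟨ cong (λ x → k * (x + prSum Y))
                                                     (family-prSum {v} pen ¬first cnt≡j leaves last) ⟨
    k * (prSum (full zs) + prSum Y)          ≡⟨ cong (k *_) (prSum-++ (full zs) Y) ⟨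
    k * prSum (full zs ++ Y)                 ≡⟨ cong (λ X → k * prSum X) split ⟨
    k * prSum (go (suc b) (v ∷ ws ++ w ∷ xs)) ∎
    where
    open ≡-Reasoning
    zs = v ∷ ws ++ [ w ]
    Y = go (suc b ∸ labels zs) xs
    regroup : v ∷ ws ++ w ∷ xs ≡ zs ++ xs
    regroup = cong (v ∷_) (sym (++-assoc ws [ w ] xs))
    fits : labels zs ≤ suc b
    fits = subst (_≤ suc b)
      (sym (trans (labels-++ (v ∷ ws) [ w ]) (cong (_+_ (labels (v ∷ ws))) (+-identityʳ (cnt w)))))
      (family-fits E b pen last w∈ unique complete)
    split : go (suc b) (v ∷ ws ++ w ∷ xs) ≡ full zs ++ Y
    split = trans (cong (go (suc b)) regroup)
      (go-++ xs (suc b) (v ∷ LastLabelled-∷ʳ ws (subst (0 <_) (sym (proj₂ last)) z<s)) fits)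
    IH : leafSum Y ≡ k * prSum Y
    IH = leafSum≡k*prSum (E ++ full zs) (suc b ∸ labels zs) blocks
      (unique-shift E (full zs) (subst (λ as → Unique (map proj₁ E ++ as))
                                       (trans regroup (cong (_++ xs) (sym (proj₁-full zs)))) unique))
      (complete-shift E (full zs) Y (subst (λ X → CompleteList (E ++ X)) split complete))

  child : ℕ → List ℕ → ℕ → Addr
  child i q c = (i , q ++ [ c ])

  penOf : ℕ → List ℕ → Maybe Tree → Bool
  penOf i q m = not (leafOf m) ∧ allB isLeafK (map (child i q) (upTo (childCount m)))

  nChildren≡childCount : ∀ i q → nChildren (i , q) ≡ childCount (subtree (Kt i) q)
  nChildren≡childCount i q with subtree (Kt i) q
  ... | just (node ts) = refl
  ... | nothing = refl

  childrenK-regular : ∀ i q → superChild (i , q) ≡ [] →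
                      childrenK (i , q) ≡ map (child i q) (upTo (childCount (subtree (Kt i) q)))
  childrenK-regular i q sc = trans (cong₂ (λ n cs → map (child i q) (upTo n) ++ cs) (nChildren≡childCount i q) sc)
                                   (++-identityʳ _)

  isLeafK-regular : ∀ i q → superChild (i , q) ≡ [] → isLeafK (i , q) ≡ leafOf (subtree (Kt i) q)
  isLeafK-regular i q sc = trans (cong null (childrenK-regular i q sc)) (null-children (subtree (Kt i) q))
    where
    null-children : ∀ m → null (map (child i q) (upTo (childCount m))) ≡ leafOf m
    null-children (just (node [])) = refl
    null-children (just (node (_ ∷ _))) = refl
    null-children nothing = refl

  isPenK-regular : ∀ i q → superChild (i , q) ≡ [] → isPenK (i , q) ≡ penOf i q (subtree (Kt i) q)
  isPenK-regular i q sc = cong₂ (λ l cs → not l ∧ allB isLeafK cs) (isLeafK-regular i q sc) (childrenK-regular i q sc)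

  superChild-child : ∀ i q c → superChild (child i q c) ≡ []
  superChild-child zero q c = refl
  superChild-child (suc zero) q c = refl
  superChild-child (suc (suc i)) [] c = refl
  superChild-child (suc (suc i)) (_ ∷ _) c = refl

  cnt-child : ∀ i q c → cnt (child i q c) ≡ j
  cnt-child i [] c = refl
  cnt-child i (_ ∷ _) c = refl

  isLeafK-child : ∀ i q ts c → subtree (Kt i) q ≡ just (node ts) → isLeafK (child i q c) ≡ leafOf (nth ts c)
  isLeafK-child i q ts c at-q =
    trans (isLeafK-regular i (q ++ [ c ]) (superChild-child i q c)) (cong leafOf (subtree-∷ʳ (Kt i) q ts c at-q))

  isPenK-leaf-children : ∀ i q t ts → superChild (i , q) ≡ [] → subtree (Kt i) q ≡ just (node (t ∷ ts)) →
                         (∀ c → isLeafK (child i q c) ≡ true) → isPenK (i , q) ≡ true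
  isPenK-leaf-children i q t ts sc at-q leaves = trans (isPenK-regular i q sc)
    (trans (cong (penOf i q) at-q) (allB-map isLeafK (child i q) (upTo (length (t ∷ ts))) leaves))

  isPenK-nonleaf-child : ∀ i q t ts → superChild (i , q) ≡ [] → subtree (Kt i) q ≡ just (node (t ∷ ts)) →
                         isLeafK (child i q 0) ≡ false → isPenK (i , q) ≡ false
  isPenK-nonleaf-child i q t ts sc at-q ¬leaf = trans (isPenK-regular i q sc)
    (trans (cong (penOf i q) at-q) (cong (_∧ allB isLeafK (map (child i q) (applyUpTo suc (length ts)))) ¬leaf))

  child∈childrenK : ∀ i q ts c → superChild (i , q) ≡ [] → subtree (Kt i) q ≡ just (node ts) →
                    c < length ts → child i q c ∈ childrenK (i , q)
  child∈childrenK i q ts c sc at-q c<ts = subst (child i q c ∈_)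
    (sym (trans (childrenK-regular i q sc) (cong (λ m → map (child i q) (upTo (childCount m))) at-q)))
    (∈-map⁺ (child i q) (∈-upTo⁺ c<ts))

  supernode-¬leaf : ∀ i → isLeafK (suc (suc i) , []) ≡ false
  supernode-¬leaf i = null-∷ʳ (map (child (suc (suc i)) []) (upTo (nChildren (suc (suc i) , [])))) (suc i , [])

  supernode-¬pen : ∀ i → isPenK (suc (suc (suc i)) , []) ≡ false
  supernode-¬pen i = trans
    (cong (not (isLeafK (suc (suc (suc i)) , [])) ∧_)
          (allB-∷ʳ isLeafK (map (child (suc (suc (suc i))) []) (upTo (nChildren (suc (suc (suc i)) , []))))
                   (supernode-¬leaf i)))
    (∧-zeroʳ _)

  -- Above level p every 𝒦_i splits into blocks

  module Level (i₁ : ℕ) where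
    i : ℕ
    i = suc (suc (suc i₁))

    below : List ℕ → List ℕ → Addr
    below q r = (i , q ++ r)

    map-below-∷ : ∀ q c rs → map (below q) (map (c ∷_) rs) ≡ map (below (q ++ [ c ])) rs
    map-below-∷ q c [] = refl
    map-below-∷ q c (r ∷ rs) = cong₂ _∷_ (cong (i ,_) (sym (++-assoc q [ c ] r))) (map-below-∷ q c rs)

    map-below-pre : ∀ q c t → map (below q) (map (c ∷_) (pre t))
                                ≡ child i q c ∷ map (below (q ++ [ c ])) (preL 0 (children t))
    map-below-pre q c (node ts) = cong (child i q c ∷_) (map-below-∷ q c (preL 0 ts))

    fullLeaves : ∀ q c m → (∀ c′ → FullLeaf (child i q c′)) →
                 All FullLeaf (map (below q) (preL c (replicate m (node []))))
    fullLeaves q c zero _ = []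
    fullLeaves q c (suc m) full = full c ∷ fullLeaves q (suc c) m full

    mutual
      blocks-subtree : ∀ q c u → subtree (Kt i) (q ++ [ c ]) ≡ just (attach k u) →
                       Blocks (child i q c ∷ map (below (q ++ [ c ])) (preL 0 (children (attach k u))))
      blocks-subtree q c (node []) at-q′ = subst (λ L → Blocks (child i q c ∷ L)) (sym split)
        (family (child i q c) ws (child i q′ k′) pen refl (cnt-child i q c)
                (fullLeaves q′ 0 k′ fullLeaf) (fullLeaf k′) len w∈ [])
        where
        q′ = q ++ [ c ]
        ws = map (below q′) (preL 0 (replicate k′ (node [])))
        split : map (below q′) (preL 0 (replicate k (node []))) ≡ ws ++ [ child i q′ k′ ]
        split = trans (cong (map (below q′)) (preL-replicate-∷ʳ 0 k′))
                      (map-++ (below q′) (preL 0 (replicate k′ (node []))) _)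
        fullLeaf : ∀ c′ → FullLeaf (child i q′ c′)
        fullLeaf c′ = trans (isLeafK-child i q′ _ c′ at-q′) (leafOf-nth (replicate⁺ k refl) c′)
                    , cnt-child i q′ c′
        len : length ws ≡ k′
        len = trans (length-map (below q′) (preL 0 (replicate k′ (node [])))) (length-preL-replicate 0 k′)
        pen : isPenK (child i q c) ≡ true
        pen = isPenK-leaf-children i q′ _ _ (superChild-child i q c) at-q′ (proj₁ ∘ fullLeaf)
        w∈ : child i q′ k′ ∈ childrenK (child i q c)
        w∈ = child∈childrenK i q′ _ k′ (superChild-child i q c) at-q′
               (subst (k′ <_) (sym (length-replicate k)) ≤-refl)
      blocks-subtree q c (node (x ∷ xs)) at-q′ =
        inner (child i q c) ¬leaf ¬pen (blocks-children (q ++ [ c ]) [] (x ∷ xs) at-q′)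
        where
        ¬leaf : isLeafK (child i q c) ≡ false
        ¬leaf = trans (isLeafK-regular i (q ++ [ c ]) (superChild-child i q c)) (cong leafOf at-q′)
        ¬pen : isPenK (child i q c) ≡ false
        ¬pen = isPenK-nonleaf-child i (q ++ [ c ]) _ _ (superChild-child i q c) at-q′
                 (trans (isLeafK-child i (q ++ [ c ]) _ 0 at-q′) (leafOf-attach k′ x))

      blocks-children : ∀ q pl us → subtree (Kt i) q ≡ just (node (pl ++ attL k us)) →
                        Blocks (map (below q) (preL (length pl) (attL k us)))
      blocks-children q pl [] _ = []
      blocks-children q pl (u ∷ us) at-q =
        subst Blocks (sym (map-++ (below q) (map (c ∷_) (pre (attach k u))) (preL (suc c) (attL k us))))
          (Blocks-++ (subst Blocks (sym (map-below-pre q c (attach k u))) (blocks-subtree q c u at-child)) rest)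
        where
        c = length pl
        at-child : subtree (Kt i) (q ++ [ c ]) ≡ just (attach k u)
        at-child = trans (subtree-∷ʳ (Kt i) q _ c at-q) (nth-length pl _ _)
        rest : Blocks (map (below q) (preL (suc c) (attL k us)))
        rest = subst (λ c′ → Blocks (map (below q) (preL c′ (attL k us))))
          (trans (length-++ pl) (+-comm c 1))
          (blocks-children q (pl ++ [ attach k u ]) us
             (trans at-q (cong (λ ts → just (node ts)) (sym (++-assoc pl [ attach k u ] (attL k us))))))

    blocks-root : ∀ x xs → Kt i ≡ attach k (node (x ∷ xs)) → Blocks (map (i ,_) (order i))
    blocks-root x xs Kt≡ = subst (λ t → Blocks (map (i ,_) (pre t))) (sym Kt≡)
      (inner (i , []) (supernode-¬leaf (suc i₁)) (supernode-¬pen i₁)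
             (blocks-children [] [] (x ∷ xs) (cong just Kt≡)))

  T-branching : Branching T
  T-branching = 0<height⇒branching T (≤-trans (s≤s z≤n) 2≤p)

  Kt-above : ∀ i → p < suc (suc i) → Kt (suc (suc i)) ≡ attach k (iter (suc (suc i) ∸ suc p) (attach k) T)
  Kt-above i p<i = trans
    (cong (λ b → if b then iter (p ∸ suc (suc i)) deleteLeaves T else iter (suc (suc i) ∸ p) (attach k) T)
          (≤ᵇ-false p<i))
    (cong (λ m → iter m (attach k) T) (+-∸-assoc 1 p<i))

  blocks-level : ∀ i → p < i → Blocks (map (i ,_) (order i))
  blocks-level (suc zero) (s≤s p≤0) = contradiction (≤-trans 2≤p p≤0) λ ()
  blocks-level (suc (suc zero)) (s≤s p≤1) = contradiction (≤-trans 2≤p p≤1) λ { (s≤s ()) }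
  blocks-level (suc (suc (suc i₁))) p<i with iter-attach-branching k (suc (suc (suc i₁)) ∸ suc p) T-branching
  ... | x , xs , eq = Level.blocks-root i₁ x xs (trans (Kt-above (suc i₁) p<i) (cong (attach k) eq))

  levels : ℕ → ℕ → List Addr
  levels a zero = []
  levels a (suc d) = levels a d ++ map (suc (d + a) ,_) (order (suc (d + a)))

  trav-+ : ∀ a d → trav (d + a) ≡ trav a ++ levels a d
  trav-+ a zero = sym (++-identityʳ (trav a))
  trav-+ a (suc d) = trans (cong (_++ map (suc (d + a) ,_) (order (suc (d + a)))) (trav-+ a d))
                           (++-assoc (trav a) (levels a d) _)

  levels-blocks : ∀ a d → p ≤ a → Blocks (levels a d)
  levels-blocks a zero _ = []
  levels-blocks a (suc d) p≤a =
    Blocks-++ (levels-blocks a d p≤a) (blocks-level (suc (d + a)) (s≤s (≤-trans p≤a (m≤n+m a d))))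

  Kt-below : ∀ i → suc (suc i) ≤ p → Kt (suc (suc i)) ≡ iter (p ∸ suc (suc i)) deleteLeaves T
  Kt-below i i≤p = cong
    (λ b → if b then iter (p ∸ suc (suc i)) deleteLeaves T else iter (suc (suc i) ∸ p) (attach k) T)
    (≤ᵇ-true i≤p)

  Kt-below-branching : ∀ i → suc (suc i) ≤ p → Branching (Kt (suc (suc i)))
  Kt-below-branching i i≤p = 0<height⇒branching (Kt (suc (suc i)))
    (subst (0 <_) (sym (trans (cong height (Kt-below i i≤p))
                              (trans (height-iter-deleteLeaves (p ∸ suc (suc i)) T) (m∸[m∸n]≡n i≤p))))
           z<s)

  labelled⇒LastLabelled : ∀ z zs → All (λ y → 0 < cnt y) (z ∷ zs) → LastLabelled (z ∷ zs)
  labelled⇒LastLabelled z [] (0<z ∷ []) = end 0<z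
  labelled⇒LastLabelled z (y ∷ zs) (_ ∷ rest) = z ∷ labelled⇒LastLabelled y zs rest

  heads⇒labelled : ∀ i {c qs} → All (HeadAtLeast c) qs → All (λ y → 0 < cnt y) (map (i ,_) qs)
  heads⇒labelled i [] = []
  heads⇒labelled i (_∷_ {_ ∷ _} _ heads) = z<s ∷ heads⇒labelled i heads

  LastLabelled-pre : ∀ i t → Branching t → LastLabelled (map (i ,_) (pre t))
  LastLabelled-pre i _ (node us , cs , refl) =
    (i , []) ∷ labelled⇒LastLabelled (i , [ 0 ]) _ (heads⇒labelled i (preL-heads 0 (node us ∷ cs)))

  LastLabelled-trav : ∀ a → 2 ≤ a → a ≤ p → LastLabelled (trav a)
  LastLabelled-trav (suc zero) (s≤s ()) _
  LastLabelled-trav (suc (suc a)) _ a≤p =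
    LastLabelled-++ (trav (suc a)) (LastLabelled-pre (suc (suc a)) (Kt (suc (suc a))) (Kt-below-branching a a≤p))

  0<labels-level : ∀ a → suc a ≤ p → 0 < labels (map (suc a ,_) (order (suc a)))
  0<labels-level zero _ = z<s
  0<labels-level (suc a) a≤p = LastLabelled⇒0<labels
    (LastLabelled-pre (suc (suc a)) (Kt (suc (suc a))) (Kt-below-branching a a≤p))

  a≤labels-trav : ∀ a → a ≤ p → a ≤ labels (trav a)
  a≤labels-trav zero _ = z≤n
  a≤labels-trav (suc a) a<p = subst (suc a ≤_) (sym (labels-++ (trav a) _))
    (subst (_≤ labels (trav a) + labels (map (suc a ,_) (order (suc a)))) (+-comm a 1)
      (+-mono-≤ (a≤labels-trav a (<⇒≤ a<p)) (0<labels-level a a<p)))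

  first-supernode-pen : isPenK (1 , []) ≡ true
  first-supernode-pen = isPenK-leaf-children 1 [] (node []) (children core1) refl refl λ c →
    trans (isLeafK-child 1 [] (node [] ∷ children core1) c refl)
          (leafOf-nth (refl ∷ height≤1⇒leaf-children core1 core1-height≤1) c)
    where
    core1-height≤1 : height core1 ≤ 1
    core1-height≤1 = subst (_≤ 1) (sym (height-iter-deleteLeaves (p ∸ 1) T))
                            (≤-reflexive (m∸[m∸n]≡n (≤-trans (s≤s z≤n) 2≤p)))

  NotFirst : List Addr → Set
  NotFirst = All (λ v → isFirstSuper v ≡ false)

  prSum≡penSum : ∀ xs → NotFirst xs → prSum (full xs) ≡ penSum (full xs)
  prSum≡penSum [] [] = refl
  prSum≡penSum (x ∷ xs) (¬first ∷ rest) =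
    cong₂ _+_ (cong (λ f → if isPenK x then (if f then j else cnt x) else 0) ¬first) (prSum≡penSum xs rest)

  notFirst-level : ∀ i → 2 ≤ i → ∀ qs → NotFirst (map (i ,_) qs)
  notFirst-level (suc zero) (s≤s ()) _
  notFirst-level (suc (suc i)) _ qs = map⁺ (All.universal (λ _ → refl) qs)

  notFirst-level-1 : ∀ {qs} → All (HeadAtLeast 1) qs → NotFirst (map (1 ,_) qs)
  notFirst-level-1 [] = []
  notFirst-level-1 (_∷_ {_ ∷ _} _ heads) = refl ∷ notFirst-level-1 heads

  notFirst-levels : ∀ a d → 1 ≤ a → NotFirst (levels a d)
  notFirst-levels a zero _ = []
  notFirst-levels a (suc d) 1≤a =
    ++⁺ (notFirst-levels a d 1≤a) (notFirst-level (suc (d + a)) (s≤s (≤-trans 1≤a (m≤n+m a d))) _)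

  private
    swap-summands : ∀ x y a b → (x + (a + y)) + b ≡ (x + (b + y)) + a
    swap-summands = solve-∀

  -- 𝒫𝒦 gives the first supernode j labels where 𝒦 gives it s; it is the only such node.
  prefix-balance : prSum (full (trav p)) + s ≡ β + j
  prefix-balance = subst (λ a → prSum (full (trav a)) + s ≡ penSum (full (trav a)) + j)
                         (m∸n+n≡m (≤-trans (s≤s z≤n) 2≤p)) (from-level-1 (p ∸ 1))
    where
    from-level-1 : ∀ d → prSum (full (trav (d + 1))) + s ≡ penSum (full (trav (d + 1))) + j
    from-level-1 d = subst (λ xs → prSum (full xs) + s ≡ penSum (full xs) + j) (sym (trav-+ 1 d)) (begin
      (extra + (prW ((1 , []) , s) + prSum (full rest))) + s
        ≡⟨ cong (λ q → (extra + ((if q then j else 0) + prSum (full rest))) + s) first-supernode-pen ⟩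
      (extra + (j + prSum (full rest))) + s
        ≡⟨ cong (λ y → (extra + (j + y)) + s) (prSum≡penSum rest notFirst) ⟩
      (extra + (j + penSum (full rest))) + s
        ≡⟨ swap-summands extra (penSum (full rest)) j s ⟩
      (extra + (s + penSum (full rest))) + j
        ≡⟨ cong (λ q → (extra + ((if q then s else 0) + penSum (full rest))) + j) (sym first-supernode-pen) ⟩
      (extra + ((if isPenK (1 , []) then s else 0) + penSum (full rest))) + j ∎)
      where
      open ≡-Reasoning
      extra = if isPenK (1 , [ 0 ]) then j else 0
      rest = map (1 ,_) (preL 1 (children core1)) ++ levels 1 d
      notFirst : NotFirst rest
      notFirst = ++⁺ (notFirst-level-1 (preL-heads 1 (children core1))) (notFirst-levels 1 d ≤-refl)

  p≤N : p ≤ N p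
  p≤N = a≤labels-trav p ≤-refl

  trav-split : ∀ n → p ≤ n → trav n ≡ trav p ++ levels p (n ∸ p)
  trav-split n p≤n = trans (cong trav (sym (m∸n+n≡m p≤n))) (trav-+ p (n ∸ p))

  Tail : ℕ → List (Addr × ℕ)
  Tail n = go (n ∸ N p) (levels p (n ∸ p))

  Kn-split : ∀ n → N p ≤ n → Kn n ≡ full (trav p) ++ Tail n
  Kn-split n N≤n = trans (cong (go n) (trav-split n (≤-trans p≤N N≤n)))
                         (go-++ (levels p (n ∸ p)) n (LastLabelled-trav p 2≤p ≤-refl) N≤n)

  tail-balance : ∀ n → N p ≤ n → Complete n → leafSum (Tail n) ≡ k * prSum (Tail n)
  tail-balance n N≤n complete =
    leafSum≡k*prSum (full (trav p)) (n ∸ N p) (levels-blocks p (n ∸ p) ≤-refl)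
      (subst Unique (trans (trav-split n (≤-trans p≤N N≤n))
                           (cong (_++ levels p (n ∸ p)) (sym (proj₁-full (trav p)))))
             (trav-unique n))
      (subst CompleteList (Kn-split n N≤n) complete)

  R-split : ∀ n → N p ≤ n → Complete n → R n ≡ α + k * prSum (Tail n)
  R-split n N≤n complete = trans (cong leafSum (Kn-split n N≤n))
    (trans (sumWhere-++ isLeafK (full (trav p)) (Tail n)) (cong (_+_ α) (tail-balance n N≤n complete)))

  PR-split : ∀ n → N p ≤ n → PR n ≡ prSum (full (trav p)) + prSum (Tail n)
  PR-split n N≤n = trans (cong prSum (Kn-split n N≤n)) (prSum-++ (full (trav p)) (Tail n))

lemma2 : (k j s : ℕ) .{{_ : NonZero k}} → 1 ≤ j → (T : Tree) → 2 ≤ height T →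
    (n : ℕ) → Construction.N k j s T (height T) ≤ n → Construction.Complete k j s T n →
      (+ Construction.PR k j s T n) / 1 ≡ (+ Construction.R k j s T n - Construction.ν k j s T) / k
lemma2 zero _ _ {{k≢0}} _ _ _ _ _ _ = ⊥-elim-irr (NonZero.nonZero k≢0)
lemma2 (suc k′) (suc j′) s _ T 2≤p n N≤n complete = begin
  + PR n / 1                                 ≡⟨ cong (λ x → + x / 1) (PR-split n N≤n) ⟩
  + (A + prSum (Tail n)) / 1                 ≡⟨ PR-formula k′ α β s j A (prSum (Tail n)) prefix-balance ⟩
  (+ (α + k * prSum (Tail n)) - ν) / k       ≡⟨ cong (λ x → (+ x - ν) / k) (R-split n N≤n complete) ⟨
  (+ R n - ν) / k                            ∎
  where
  open ConstructionProperties k′ j′ s T 2≤p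
  open Construction k j s T
  open ≡-Reasoning
  A = prSum (full (trav p))
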